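{- Let $X,Y$ be 2-3 trees and let $J=X+Y$. Then whether $J$ overflows (i.e. $\mathrm{height}(J)>\mathrm{height}(X)$ and $\mathrm{height}(J)>\mathrm{height}(Y)$), together with $\mathrm{lspine}(J)$ and $\mathrm{rspine}(J)$, can be computed within $O(1)$ steps of integer arithmetic (addition, subtraction, multiplication, modulo, comparison) from the six integers $\mathrm{weight}(X)$, $\mathrm{lspine}(X)$, $\mathrm{rspine}(X)$, $\mathrm{weight}(Y)$, $\mathrm{lspine}(Y)$, $\mathrm{rspine}(Y)$.
   Context: A 2-3 tree is a rooted tree whose leaves are all at the same depth and whose internal nodes each have $2$ or $3$ ordered children. The height of a node $v$ is the height of the subtree at $v$ (leaves have height $0$), and $\mathrm{weight}(v)=2^{\mathrm{height}(v)}$. For a node $v$, $\mathrm{rspine}(v)=\sum_{k=1}^{\mathrm{height}(v)}(c_k-2)\cdot 2^{k-1}$, where $c_k$ is the number of children of the node at height $k$ on the rightmost root-to-leaf path of the subtree at $v$; $\mathrm{lspine}(v)$ is defined symmetrically using the leftmost path. For a tree, these quantities refer to its root. $X+Y$ denotes the standard join of 2-3 trees, yielding a 2-3 tree whose leaves are those of $X$ followed by those of $Y$: if $X,Y$ have equal height, a new root with children $X,Y$ is created; if $X$ is taller, $Y$ is added as the right sibling immediately after the node on the right spine of $X$ having the same height as $Y$, and then, repeatedly going upward, any node with $4$ children is split into two $2$-child nodes (creating a new root if the root splits); symmetrically if $Y$ is taller. -}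

module Defs where

open import Data.Nat as ℕ using (ℕ; zero; suc; _^_; compare; less; equal; greater)
open import Data.Nat.Properties using (+-comm)
open import Data.Integer as ℤ using (ℤ; +_; ∣_∣)
open import Data.Integer.DivMod using (_%ℕ_)
open import Data.Fin using (Fin)
open import Data.Product using (Σ; _,_; proj₁; proj₂)
open import Relation.Nullary using (does)
open import Data.Bool using (if_then_else_)
open import Relation.Binary.PropositionalEquality using (_≡_; refl; cong)

-- 2-3 trees, indexed by height (all leaves at the same depth).
-- Leaves carry no data: only the shape matters for the quantities here.

data T : ℕ → Set where
  leaf  : T 0
  node2 : ∀ {n} → T n → T n → T (suc n)
  node3 : ∀ {n} → T n → T n → T n → T (suc n)

Tree23 : Set
Tree23 = Σ ℕ T

height : Tree23 → ℕ
height = proj₁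

weight : Tree23 → ℕ
weight t = 2 ^ height t

-- rspine(v) = Σ_{k=1}^{height v} (c_k - 2) 2^{k-1}, c_k = #children on the right spine
rspineT : ∀ {n} → T n → ℕ
rspineT leaf = 0
rspineT (node2 a b) = rspineT b
rspineT {suc h} (node3 a b c) = 2 ^ h ℕ.+ rspineT c

lspineT : ∀ {n} → T n → ℕ
lspineT leaf = 0
lspineT (node2 a b) = lspineT a
lspineT {suc h} (node3 a b c) = 2 ^ h ℕ.+ lspineT a

rspine : Tree23 → ℕ
rspine (_ , t) = rspineT t

lspine : Tree23 → ℕ
lspine (_ , t) = lspineT t

-- Result of inserting into a subtree of height n: either a tree of
-- height n, or (after a 4-child node was split) two trees of height n
-- to be placed as consecutive siblings.
data Ins (n : ℕ) : Set where
  ok    : T n → Ins n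
  split : T n → T n → Ins n

insR : ∀ {m k} (d : ℕ) → d ℕ.+ k ≡ m → T m → T k → Ins m
insR zero refl x y = split x y
insR (suc d) refl (node2 a b) y with insR d refl b y
... | ok b'       = ok (node2 a b')
... | split b1 b2 = ok (node3 a b1 b2)
insR (suc d) refl (node3 a b c) y with insR d refl c y
... | ok c'       = ok (node3 a b c')
... | split c1 c2 = split (node2 a b) (node2 c1 c2)

insL : ∀ {m k} (d : ℕ) → d ℕ.+ k ≡ m → T k → T m → Ins m
insL zero refl x y = split x y
insL (suc d) refl x (node2 a b) with insL d refl x a
... | ok a'       = ok (node2 a' b)
... | split a1 a2 = ok (node3 a1 a2 b)
insL (suc d) refl x (node3 a b c) with insL d refl x a
... | ok a'       = ok (node3 a' b c)
... | split a1 a2 = split (node2 a1 a2) (node2 b c)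

finish : ∀ {m} → Ins m → Tree23
finish {m} (ok t)      = m , t
finish {m} (split a b) = suc m , node2 a b

join : Tree23 → Tree23 → Tree23
join (m , x) (n , y) with compare m n
... | less .m k    = finish (insL (suc k) (cong suc (+-comm k m)) x y)
... | equal .m     = suc m , node2 x y
... | greater .n k = finish (insR (suc k) (cong suc (+-comm k n)) x y)

Overflows : Tree23 → Tree23 → Set
Overflows X Y = height X ℕ.< height (join X Y) Data.Product.× height Y ℕ.< height (join X Y)
  where import Data.Product

-- Straight-line integer arithmetic: finite expressions over input
-- variables built from constants, +, -, *, mod and comparison
-- (if a ≤ b then c else d).  A fixed expression takes O(1) steps.

data Expr (n : ℕ) : Set where
  var   : Fin n → Expr n
  lit   : ℤ → Expr n
  _⊕_   : Expr n → Expr n → Expr n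
  _⊖_   : Expr n → Expr n → Expr n
  _⊗_   : Expr n → Expr n → Expr n
  _mod_ : Expr n → Expr n → Expr n
  ifLeq : Expr n → Expr n → Expr n → Expr n → Expr n

-- a mod b = a mod |b| (in [0,|b|)), with the convention a mod 0 = a.
modℤ : ℤ → ℤ → ℤ
modℤ a b with ∣ b ∣
... | zero  = a
... | suc k = + (a %ℕ suc k)

eval : ∀ {n} → Expr n → (Fin n → ℤ) → ℤ
eval (var i) ρ = ρ i
eval (lit c) ρ = c
eval (a ⊕ b) ρ = eval a ρ ℤ.+ eval b ρ
eval (a ⊖ b) ρ = eval a ρ ℤ.- eval b ρ
eval (a ⊗ b) ρ = eval a ρ ℤ.* eval b ρ
eval (a mod b) ρ = modℤ (eval a ρ) (eval b ρ)
eval (ifLeq a b c d) ρ = if does (eval a ρ ℤ.≤? eval b ρ) then eval c ρ else eval d ρ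

inputs : Tree23 → Tree23 → Fin 6 → ℤ
inputs X Y Fin.zero = + weight X
inputs X Y (Fin.suc Fin.zero) = + lspine X
inputs X Y (Fin.suc (Fin.suc Fin.zero)) = + rspine X
inputs X Y (Fin.suc (Fin.suc (Fin.suc Fin.zero))) = + weight Y
inputs X Y (Fin.suc (Fin.suc (Fin.suc (Fin.suc Fin.zero)))) = + lspine Y
inputs X Y (Fin.suc (Fin.suc (Fin.suc (Fin.suc (Fin.suc Fin.zero))))) = + rspine Y
  where import Data.Fin as Fin

module Submission where

-- Read rspine(v) as a binary numeral whose digit at position k − 1 is c_k − 2, so rspine(v) < weight(v).
-- When X is taller, Y becomes a new child of the node of height k = height(Y) on the right spine of X;
-- a node that reaches 4 children splits and hands one child up, exactly like a carry.  Hence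
--   rspine(J) + [J overflows] · weight(X) = (rspine(X) rounded down to a multiple of weight(Y)) + weight(Y) + rspine(Y),
-- and comparing the right-hand side with weight(X) yields the overflow bit and rspine(J).  On the left spine
-- only the digit of the root of X can change, and in J the nodes of height height(X) on the two spines have
-- the same number of children (they are one node, or two fresh 2-nodes after a root split), so that digit is
-- read off from rspine(J) by comparison with weight(X)/2.  A taller Y is symmetric; equal heights add a root.

open import Defs
open import Data.Integer using (+_)
open import Data.Product using (Σ; _×_)
open import Function.Bundles using (_⇔_)
open import Relation.Binary.PropositionalEquality using (_≡_)

open import Data.Nat using (ℕ; zero; suc; _+_; _*_; _∸_; _^_; _≤_; _<_; z≤n; s≤s; compare; less; equal; greater)
open import Data.Nat.Properties
open import Data.Nat.DivMod using (_%_; [m+kn]%n≡m%n; m<n⇒m%n≡m; m%n≤m)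
open import Data.Nat.Divisibility using (_∣_; divides; ∣m∣n⇒∣m+n)
open import Data.Nat.Tactic.RingSolver using (solve-∀)
open import Data.Integer using (ℤ; +≤+)
import Data.Integer.Properties as ℤ
open import Data.Fin using (Fin; zero; suc)
open import Data.Product using (_,_; proj₁; proj₂)
open import Data.Product.Algebra using (×-comm)
open import Data.Empty using (⊥-elim)
open import Function using (_∘_)
open import Function.Bundles using (mk⇔)
open import Function.Properties.Equivalence using () renaming (trans to ⇔-trans)
open import Function.Properties.Inverse using (↔⇒⇔)
open import Relation.Nullary.Decidable using (dec-true; dec-false)
open import Relation.Binary.PropositionalEquality using (refl; sym; trans; cong; subst; module ≡-Reasoning)

m+n≡n+1*m : ∀ m n → m + n ≡ n + 1 * m
m+n≡n+1*m = solve-∀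

m+n+0≡n+0*m+1*m : ∀ m n → m + n + 0 ≡ n + 0 * m + 1 * m
m+n+0≡n+0*m+1*m = solve-∀

n+1*[2*m]≡n+1*m+1*m : ∀ m n → n + 1 * (2 * m) ≡ n + 1 * m + 1 * m
n+1*[2*m]≡n+1*m+1*m = solve-∀

m+n+o+p≡m+p+n+o : ∀ m n o p → m + n + o + p ≡ m + p + n + o
m+n+o+p≡m+p+n+o = solve-∀

TwoDigits : ℕ → ℕ → ℕ → Set
TwoDigits B c o = c < B × o ≤ 1

m<n⇒m+0*n<n : ∀ {m n} → m < n → m + 0 * n < n
m<n⇒m+0*n<n {m} = subst (_< _) (sym (+-identityʳ m))

n≤m+1*n : ∀ m n → n ≤ m + 1 * n
n≤m+1*n m n = ≤-trans (m≤m+n n 0) (m≤n+m (n + 0) m)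

twoDigits<2*base : ∀ {B c o} → TwoDigits B c o → c + o * B < 2 * B
twoDigits<2*base (c<B , z≤n) = +-mono-<-≤ c<B z≤n
twoDigits<2*base (c<B , s≤s z≤n) = +-mono-<-≤ c<B ≤-refl

-- Spines as binary numerals

-- the digit c − 2 of a node with c children
surplus : ∀ {n} → T (suc n) → ℕ
surplus (node2 _ _) = 0
surplus (node3 _ _ _) = 1

surplus≤1 : ∀ {n} (t : T (suc n)) → surplus t ≤ 1
surplus≤1 (node2 _ _) = z≤n
surplus≤1 (node3 _ _ _) = s≤s z≤n

leftChild rightChild : ∀ {n} → T (suc n) → T n
leftChild (node2 a _) = a
leftChild (node3 a _ _) = a
rightChild (node2 _ b) = b
rightChild (node3 _ _ c) = c

lspineT-root : ∀ {n} (t : T (suc n)) → lspineT t ≡ lspineT (leftChild t) + surplus t * 2 ^ n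
lspineT-root (node2 a _) = sym (+-identityʳ (lspineT a))
lspineT-root {n} (node3 a _ _) = m+n≡n+1*m (2 ^ n) (lspineT a)

rspineT-root : ∀ {n} (t : T (suc n)) → rspineT t ≡ rspineT (rightChild t) + surplus t * 2 ^ n
rspineT-root (node2 _ b) = sym (+-identityʳ (rspineT b))
rspineT-root {n} (node3 _ _ c) = m+n≡n+1*m (2 ^ n) (rspineT c)

lspineT<2^n : ∀ {n} (t : T n) → lspineT t < 2 ^ n
lspineT<2^n leaf = s≤s z≤n
lspineT<2^n (node2 a b) rewrite lspineT-root (node2 a b) = twoDigits<2*base (lspineT<2^n a , z≤n)
lspineT<2^n (node3 a b c) rewrite lspineT-root (node3 a b c) = twoDigits<2*base (lspineT<2^n a , s≤s z≤n)

rspineT<2^n : ∀ {n} (t : T n) → rspineT t < 2 ^ n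
rspineT<2^n leaf = s≤s z≤n
rspineT<2^n (node2 a b) rewrite rspineT-root (node2 a b) = twoDigits<2*base (rspineT<2^n b , z≤n)
rspineT<2^n (node3 a b c) rewrite rspineT-root (node3 a b c) = twoDigits<2*base (rspineT<2^n c , s≤s z≤n)

rightSubtree : ∀ {k} d → T (d + k) → T k
rightSubtree zero x = x
rightSubtree (suc d) x = rightSubtree d (rightChild x)

leftSubtree : ∀ {k} d → T (d + k) → T k
leftSubtree zero x = x
leftSubtree (suc d) x = leftSubtree d (leftChild x)

rspineAbove : ∀ {k} d → T (d + k) → ℕ
rspineAbove zero _ = 0
rspineAbove {k} (suc d) x = rspineAbove d (rightChild x) + surplus x * 2 ^ (d + k)

lspineAbove : ∀ {k} d → T (d + k) → ℕ
lspineAbove zero _ = 0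
lspineAbove {k} (suc d) x = lspineAbove d (leftChild x) + surplus x * 2 ^ (d + k)

rspineT-split : ∀ {k} d (x : T (d + k)) → rspineT x ≡ rspineT (rightSubtree d x) + rspineAbove d x
rspineT-split zero x = sym (+-identityʳ (rspineT x))
rspineT-split {k} (suc d) x = begin
  rspineT x                                        ≡⟨ rspineT-root x ⟩
  rspineT (rightChild x) + S                       ≡⟨ cong (_+ S) (rspineT-split d (rightChild x)) ⟩
  rspineT below + rspineAbove d (rightChild x) + S ≡⟨ +-assoc (rspineT below) _ S ⟩
  rspineT below + rspineAbove (suc d) x            ∎
  where
    open ≡-Reasoning
    S = surplus x * 2 ^ (d + k)
    below = rightSubtree (suc d) x

lspineT-split : ∀ {k} d (x : T (d + k)) → lspineT x ≡ lspineT (leftSubtree d x) + lspineAbove d x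
lspineT-split zero x = sym (+-identityʳ (lspineT x))
lspineT-split {k} (suc d) x = begin
  lspineT x                                       ≡⟨ lspineT-root x ⟩
  lspineT (leftChild x) + S                       ≡⟨ cong (_+ S) (lspineT-split d (leftChild x)) ⟩
  lspineT below + lspineAbove d (leftChild x) + S ≡⟨ +-assoc (lspineT below) _ S ⟩
  lspineT below + lspineAbove (suc d) x           ∎
  where
    open ≡-Reasoning
    S = surplus x * 2 ^ (d + k)
    below = leftSubtree (suc d) x

2^k∣surplus*2^[d+k] : ∀ {k} d (x : T (suc (d + k))) → 2 ^ k ∣ surplus x * 2 ^ (d + k)
2^k∣surplus*2^[d+k] {k} d x = divides (surplus x * 2 ^ d) (begin
  surplus x * 2 ^ (d + k)         ≡⟨ cong (surplus x *_) (^-distribˡ-+-* 2 d k) ⟩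
  surplus x * (2 ^ d * 2 ^ k)     ≡⟨ sym (*-assoc (surplus x) _ _) ⟩
  surplus x * 2 ^ d * 2 ^ k       ∎)
  where open ≡-Reasoning

2^k∣rspineAbove : ∀ {k} d (x : T (d + k)) → 2 ^ k ∣ rspineAbove d x
2^k∣rspineAbove zero x = divides 0 refl
2^k∣rspineAbove (suc d) x = ∣m∣n⇒∣m+n (2^k∣rspineAbove d (rightChild x)) (2^k∣surplus*2^[d+k] d x)

2^k∣lspineAbove : ∀ {k} d (x : T (d + k)) → 2 ^ k ∣ lspineAbove d x
2^k∣lspineAbove zero x = divides 0 refl
2^k∣lspineAbove (suc d) x = ∣m∣n⇒∣m+n (2^k∣lspineAbove d (leftChild x)) (2^k∣surplus*2^[d+k] d x)

-- Joining along a spine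

overflow : ∀ {m} → Ins m → ℕ
overflow (ok _) = 0
overflow (split _ _) = 1

firstTree lastTree : ∀ {m} → Ins m → T m
firstTree (ok t) = t
firstTree (split a _) = a
lastTree (ok t) = t
lastTree (split _ b) = b

rspineIns lspineIns : ∀ {m} → Ins m → ℕ
rspineIns {m} r = rspineT (lastTree r) + overflow r * 2 ^ m
lspineIns {m} r = lspineT (firstTree r) + overflow r * 2 ^ m

insR-step : ∀ {k} d (x : T (suc d + k)) (y : T k) →
  rspineIns (insR (suc d) refl x y) ≡ rspineIns (insR d refl (rightChild x) y) + surplus x * 2 ^ (d + k)
insR-step d (node2 a b) y with insR d refl b y
... | ok b′       = sym (+-identityʳ _)
... | split b₁ b₂ = cong (_+ 0) (m+n≡n+1*m _ (rspineT b₂))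
insR-step d (node3 a b c) y with insR d refl c y
... | ok c′       = m+n+0≡n+0*m+1*m _ (rspineT c′)
... | split c₁ c₂ = n+1*[2*m]≡n+1*m+1*m _ (rspineT c₂)

insR-carry : ∀ {k} d (x : T (d + k)) (y : T k) → rspineIns (insR d refl x y) ≡ rspineAbove d x + 2 ^ k + rspineT y
insR-carry {k} zero x y = trans (+-comm (rspineT y) (1 * 2 ^ k)) (cong (_+ rspineT y) (*-identityˡ (2 ^ k)))
insR-carry {k} (suc d) x y = begin
  rspineIns (insR (suc d) refl x y)                               ≡⟨ insR-step d x y ⟩
  rspineIns (insR d refl (rightChild x) y) + S                    ≡⟨ cong (_+ S) (insR-carry d (rightChild x) y) ⟩
  rspineAbove d (rightChild x) + 2 ^ k + rspineT y + S            ≡⟨ m+n+o+p≡m+p+n+o _ (2 ^ k) (rspineT y) S ⟩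
  rspineAbove (suc d) x + 2 ^ k + rspineT y                       ∎
  where
    open ≡-Reasoning
    S = surplus x * 2 ^ (d + k)

insR-lspine : ∀ {k} d (x : T (suc d + k)) (y : T k) →
  lspineT (firstTree (insR (suc d) refl x y)) ≡ lspineT (leftChild x) + surplus (lastTree (insR (suc d) refl x y)) * 2 ^ (d + k)
insR-lspine d (node2 a b) y with insR d refl b y
... | ok b′       = sym (+-identityʳ _)
... | split b₁ b₂ = m+n≡n+1*m _ (lspineT a)
insR-lspine d (node3 a b c) y with insR d refl c y
... | ok c′       = m+n≡n+1*m _ (lspineT a)
... | split c₁ c₂ = sym (+-identityʳ _)

insL-step : ∀ {k} d (x : T k) (y : T (suc d + k)) →
  lspineIns (insL (suc d) refl x y) ≡ lspineIns (insL d refl x (leftChild y)) + surplus y * 2 ^ (d + k)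
insL-step d x (node2 a b) with insL d refl x a
... | ok a′       = sym (+-identityʳ _)
... | split a₁ a₂ = cong (_+ 0) (m+n≡n+1*m _ (lspineT a₁))
insL-step d x (node3 a b c) with insL d refl x a
... | ok a′       = m+n+0≡n+0*m+1*m _ (lspineT a′)
... | split a₁ a₂ = n+1*[2*m]≡n+1*m+1*m _ (lspineT a₁)

insL-carry : ∀ {k} d (x : T k) (y : T (d + k)) → lspineIns (insL d refl x y) ≡ lspineAbove d y + 2 ^ k + lspineT x
insL-carry {k} zero x y = trans (+-comm (lspineT x) (1 * 2 ^ k)) (cong (_+ lspineT x) (*-identityˡ (2 ^ k)))
insL-carry {k} (suc d) x y = begin
  lspineIns (insL (suc d) refl x y)                               ≡⟨ insL-step d x y ⟩
  lspineIns (insL d refl x (leftChild y)) + S                     ≡⟨ cong (_+ S) (insL-carry d x (leftChild y)) ⟩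
  lspineAbove d (leftChild y) + 2 ^ k + lspineT x + S             ≡⟨ m+n+o+p≡m+p+n+o _ (2 ^ k) (lspineT x) S ⟩
  lspineAbove (suc d) y + 2 ^ k + lspineT x                       ∎
  where
    open ≡-Reasoning
    S = surplus y * 2 ^ (d + k)

insL-rspine : ∀ {k} d (x : T k) (y : T (suc d + k)) →
  rspineT (lastTree (insL (suc d) refl x y)) ≡ rspineT (rightChild y) + surplus (firstTree (insL (suc d) refl x y)) * 2 ^ (d + k)
insL-rspine d x (node2 a b) with insL d refl x a
... | ok a′       = sym (+-identityʳ _)
... | split a₁ a₂ = m+n≡n+1*m _ (rspineT b)
insL-rspine d x (node3 a b c) with insL d refl x a
... | ok a′       = m+n≡n+1*m _ (rspineT c)
... | split a₁ a₂ = sym (+-identityʳ _)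

overflow≤1 : ∀ {m} (r : Ins m) → overflow r ≤ 1
overflow≤1 (ok _) = z≤n
overflow≤1 (split _ _) = s≤s z≤n

lspine-finish : ∀ {m} (r : Ins m) → lspine (finish r) ≡ lspineT (firstTree r)
lspine-finish (ok _) = refl
lspine-finish (split _ _) = refl

rspine-finish : ∀ {m} (r : Ins m) → rspine (finish r) ≡ rspineT (lastTree r)
rspine-finish (ok _) = refl
rspine-finish (split _ _) = refl

overflow≡1⇔finish-grows : ∀ {m n} (r : Ins m) → n ≤ m →
  (overflow r ≡ 1) ⇔ (m < height (finish r) × n < height (finish r))
overflow≡1⇔finish-grows {m} (ok _) _ = mk⇔ (λ ()) (λ (m<m , _) → ⊥-elim (<-irrefl refl m<m))
overflow≡1⇔finish-grows {m} (split _ _) n≤m = mk⇔ (λ _ → n<1+n m , s≤s n≤m) (λ _ → refl)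

-- Straight-line formulas

-- w / 2 for even w > 0, since (2h)² = h (4h − 1) + h
halfE : ∀ {k} → Expr k → Expr k
halfE w = (w ⊗ w) mod ((w ⊕ w) ⊖ lit (+ 1))

roundDownE : ∀ {k} → Expr k → Expr k → Expr k
roundDownE v s = s ⊖ (s mod v)

lowE : ∀ {k} → Expr k → Expr k → Expr k
lowE b s = ifLeq b s (s ⊖ b) s

digitE : ∀ {k} → Expr k → Expr k → Expr k → Expr k
digitE b s x = ifLeq b s x (lit (+ 0))

carryE : ∀ {k} → Expr k → Expr k → Expr k → Expr k
carryE v s t = (roundDownE v s ⊕ v) ⊕ t

overflowE : ∀ {k} → Expr k → Expr k → Expr k
overflowE w c = digitE w c (lit (+ 1))

farSpineE : ∀ {k} → Expr k → Expr k → Expr k → Expr k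
farSpineE w s c = lowE h s ⊕ digitE h (lowE w c) h
  where h = halfE w

module _ {k} {ρ : Fin k → ℤ} where

  eval-⊕ : ∀ a b {x y} → eval a ρ ≡ + x → eval b ρ ≡ + y → eval (a ⊕ b) ρ ≡ + (x + y)
  eval-⊕ a b ha hb rewrite ha | hb = refl

  eval-⊖ : ∀ a b {x y} → eval a ρ ≡ + x → eval b ρ ≡ + y → y ≤ x → eval (a ⊖ b) ρ ≡ + (x ∸ y)
  eval-⊖ a b {x} {y} ha hb y≤x rewrite ha | hb = trans (ℤ.m-n≡m⊖n x y) (ℤ.⊖-≥ y≤x)

  eval-⊗ : ∀ a b {x y} → eval a ρ ≡ + x → eval b ρ ≡ + y → eval (a ⊗ b) ρ ≡ + (x * y)
  eval-⊗ a b {x} {y} ha hb rewrite ha | hb = sym (ℤ.pos-* x y)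

  eval-mod : ∀ a b {x n} → eval a ρ ≡ + x → eval b ρ ≡ + suc n → eval (a mod b) ρ ≡ + (x % suc n)
  eval-mod a b ha hb rewrite ha | hb = refl

  eval-ifLeq-≤ : ∀ a b c d {x y} → eval a ρ ≡ + x → eval b ρ ≡ + y → x ≤ y → eval (ifLeq a b c d) ρ ≡ eval c ρ
  eval-ifLeq-≤ a b c d {x} {y} ha hb x≤y rewrite ha | hb | dec-true (+ x ℤ.≤? + y) (+≤+ x≤y) = refl

  eval-ifLeq-> : ∀ a b c d {x y} → eval a ρ ≡ + x → eval b ρ ≡ + y → y < x → eval (ifLeq a b c d) ρ ≡ eval d ρ
  eval-ifLeq-> a b c d {x} {y} ha hb y<x rewrite ha | hb | dec-false (+ x ℤ.≤? + y) (<⇒≱ y<x ∘ ℤ.drop‿+≤+) = refl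

  eval-halfE : ∀ w {h} → eval w ρ ≡ + (2 * h) → 0 < h → eval (halfE w) ρ ≡ + h
  eval-halfE w {suc g} hw _ = trans (eval-mod (w ⊗ w) divisorE (eval-⊗ w w hw hw) divisor) (cong +_ square%divisor)
    where
      divisorE = (w ⊕ w) ⊖ lit (+ 1)
      double : ∀ g → 2 * suc g + 2 * suc g ≡ 1 + suc (2 + 4 * g)
      double = solve-∀
      divisor : eval divisorE ρ ≡ + suc (2 + 4 * g)
      divisor = trans (eval-⊖ (w ⊕ w) (lit (+ 1)) (eval-⊕ w w hw hw) refl (s≤s z≤n)) (cong (λ n → + (n ∸ 1)) (double g))
      square : ∀ g → 2 * suc g * (2 * suc g) ≡ suc g + suc g * suc (2 + 4 * g)
      square = solve-∀
      square%divisor : 2 * suc g * (2 * suc g) % suc (2 + 4 * g) ≡ suc g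
      square%divisor = begin
        2 * suc g * (2 * suc g) % suc (2 + 4 * g)          ≡⟨ cong (_% suc (2 + 4 * g)) (square g) ⟩
        (suc g + suc g * suc (2 + 4 * g)) % suc (2 + 4 * g) ≡⟨ [m+kn]%n≡m%n (suc g) (suc g) (suc (2 + 4 * g)) ⟩
        suc g % suc (2 + 4 * g)                            ≡⟨ m<n⇒m%n≡m (s≤s (s≤s (≤-trans (m≤n*m g 4) (n≤1+n (4 * g))))) ⟩
        suc g                                              ∎
        where open ≡-Reasoning

  eval-roundDownE : ∀ v s {V r a} → eval v ρ ≡ + V → eval s ρ ≡ + (r + a) → r < V → V ∣ a →
    eval (roundDownE v s) ρ ≡ + a
  eval-roundDownE v s {suc V} {r} {a} hv hs r<V (divides q a≡q*V) =
    trans (eval-⊖ s (s mod v) hs (eval-mod s v hs hv) (m%n≤m (r + a) (suc V))) (cong +_ [r+a]∸[r+a]%V≡a)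
    where
      [r+a]%V≡r : (r + a) % suc V ≡ r
      [r+a]%V≡r = trans (cong (λ a → (r + a) % suc V) a≡q*V) (trans ([m+kn]%n≡m%n r q (suc V)) (m<n⇒m%n≡m r<V))
      [r+a]∸[r+a]%V≡a : r + a ∸ (r + a) % suc V ≡ a
      [r+a]∸[r+a]%V≡a = trans (cong (λ m → r + a ∸ m) [r+a]%V≡r) (m+n∸m≡n r a)

  eval-carryE : ∀ v s t {V r a S} → eval v ρ ≡ + V → eval s ρ ≡ + (r + a) → r < V → V ∣ a → eval t ρ ≡ + S →
    eval (carryE v s t) ρ ≡ + (a + V + S)
  eval-carryE v s t hv hs r<V V∣a ht =
    eval-⊕ (roundDownE v s ⊕ v) t (eval-⊕ (roundDownE v s) v (eval-roundDownE v s hv hs r<V V∣a) hv) ht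

  eval-lowE : ∀ b s {B c o} → eval b ρ ≡ + B → eval s ρ ≡ + (c + o * B) → TwoDigits B c o → eval (lowE b s) ρ ≡ + c
  eval-lowE b s {c = c} hb hs (c<B , z≤n) =
    trans (eval-ifLeq-> b s (s ⊖ b) s hb hs (m<n⇒m+0*n<n c<B)) (trans hs (cong +_ (+-identityʳ c)))
  eval-lowE b s {B} {c} hb hs (c<B , s≤s z≤n) =
    trans (eval-ifLeq-≤ b s (s ⊖ b) s hb hs (n≤m+1*n c B))
          (trans (eval-⊖ s b hs hb (n≤m+1*n c B)) (cong +_ (trans (cong (λ n → c + n ∸ B) (+-identityʳ B)) (m+n∸n≡m c B))))

  eval-digitE : ∀ b s x {B c o X} → eval b ρ ≡ + B → eval s ρ ≡ + (c + o * B) → TwoDigits B c o → eval x ρ ≡ + X →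
    eval (digitE b s x) ρ ≡ + (o * X)
  eval-digitE b s x hb hs (c<B , z≤n) hx = eval-ifLeq-> b s x (lit (+ 0)) hb hs (m<n⇒m+0*n<n c<B)
  eval-digitE b s x {B} {c} {X = X} hb hs (c<B , s≤s z≤n) hx =
    trans (eval-ifLeq-≤ b s x (lit (+ 0)) hb hs (n≤m+1*n c B)) (trans hx (cong +_ (sym (+-identityʳ X))))

  eval-tallerJoin : ∀ w far carry {p cF oF cN oN o} → eval w ρ ≡ + 2 ^ suc p →
    eval far ρ ≡ + (cF + oF * 2 ^ p) → TwoDigits (2 ^ p) cF oF →
    eval carry ρ ≡ + ((cN + oN * 2 ^ p) + o * 2 ^ suc p) → TwoDigits (2 ^ p) cN oN → o ≤ 1 →
    eval (overflowE w carry) ρ ≡ + o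
      × eval (lowE w carry) ρ ≡ + (cN + oN * 2 ^ p)
      × eval (farSpineE w far carry) ρ ≡ + (cF + oN * 2 ^ p)
  eval-tallerJoin w far carry {p} {o = o} hw hs digitsF hc digitsN o≤1 =
    trans (eval-digitE w carry (lit (+ 1)) hw hc carryDigits refl) (cong +_ (*-identityʳ o)) ,
    near ,
    eval-⊕ (lowE h far) (digitE h (lowE w carry) h) (eval-lowE h far hh hs digitsF) (eval-digitE h (lowE w carry) h hh near digitsN hh)
    where
      h = halfE w
      hh : eval h ρ ≡ + 2 ^ p
      hh = eval-halfE w hw (m^n>0 2 p)
      carryDigits = twoDigits<2*base digitsN , o≤1
      near = eval-lowE w carry hw hc carryDigits

weightX lspineX rspineX weightY lspineY rspineY : Expr 6
weightX = var zero
lspineX = var (suc zero)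
rspineX = var (suc (suc zero))
weightY = var (suc (suc (suc zero)))
lspineY = var (suc (suc (suc (suc zero))))
rspineY = var (suc (suc (suc (suc (suc zero)))))

carryX carryY : Expr 6
carryX = carryE weightY rspineX rspineY
carryY = carryE weightX lspineY lspineX

byHeight : Expr 6 → Expr 6 → Expr 6 → Expr 6
byHeight onEqual onYTaller onXTaller = ifLeq weightX weightY (ifLeq weightY weightX onEqual onYTaller) onXTaller

overflowExpr lspineExpr rspineExpr : Expr 6
overflowExpr = byHeight (lit (+ 1)) (overflowE weightY carryY) (overflowE weightX carryX)
lspineExpr = byHeight lspineX (lowE weightY carryY) (farSpineE weightX lspineX carryX)
rspineExpr = byHeight rspineY (farSpineE weightY rspineY carryY) (lowE weightX carryX)

FormulasCorrect : Tree23 → Tree23 → Tree23 → Set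
FormulasCorrect X Y J =
  ((eval overflowExpr (inputs X Y) ≡ + 1) ⇔ (height X < height J × height Y < height J))
  × eval lspineExpr (inputs X Y) ≡ + lspine J
  × eval rspineExpr (inputs X Y) ≡ + rspine J

module _ (X Y : Tree23) (onEqual onYTaller onXTaller : Expr 6) where

  private
    ρ = inputs X Y
    unlessXTaller = ifLeq weightY weightX onEqual onYTaller
    2^-mono-< = ^-monoʳ-< 2 (s≤s (s≤s z≤n))

  eval-byHeight-≡ : height X ≡ height Y → eval (byHeight onEqual onYTaller onXTaller) ρ ≡ eval onEqual ρ
  eval-byHeight-≡ hX≡hY =
    trans (eval-ifLeq-≤ {ρ = ρ} weightX weightY unlessXTaller onXTaller refl refl (≤-reflexive (cong (2 ^_) hX≡hY)))
          (eval-ifLeq-≤ {ρ = ρ} weightY weightX onEqual onYTaller refl refl (≤-reflexive (cong (2 ^_) (sym hX≡hY))))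

  eval-byHeight-< : height X < height Y → eval (byHeight onEqual onYTaller onXTaller) ρ ≡ eval onYTaller ρ
  eval-byHeight-< hX<hY =
    trans (eval-ifLeq-≤ {ρ = ρ} weightX weightY unlessXTaller onXTaller refl refl (<⇒≤ (2^-mono-< hX<hY)))
          (eval-ifLeq-> {ρ = ρ} weightY weightX onEqual onYTaller refl refl (2^-mono-< hX<hY))

  eval-byHeight-> : height Y < height X → eval (byHeight onEqual onYTaller onXTaller) ρ ≡ eval onXTaller ρ
  eval-byHeight-> hY<hX =
    eval-ifLeq-> {ρ = ρ} weightX weightY unlessXTaller onXTaller refl refl (2^-mono-< hY<hX)

≡+o⇒[≡+1⇔o≡1] : ∀ {e : ℤ} {o} → e ≡ + o → (e ≡ + 1) ⇔ (o ≡ 1)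
≡+o⇒[≡+1⇔o≡1] e≡o = mk⇔ (λ e≡1 → ℤ.+-injective (trans (sym e≡o) e≡1)) (λ o≡1 → trans e≡o (cong +_ o≡1))

formulas-xTaller : ∀ {m k} d (eq : suc d + k ≡ m) (x : T m) (y : T k) →
  FormulasCorrect (m , x) (k , y) (finish (insR (suc d) eq x y))
formulas-xTaller {k = k} d refl x y =
  ⇔-trans (≡+o⇒[≡+1⇔o≡1] (trans (xTaller (lit (+ 1)) (overflowE weightY carryY) (overflowE weightX carryX)) overflow-eval))
          (overflow≡1⇔finish-grows r (<⇒≤ k<m)) ,
  trans (xTaller lspineX (lowE weightY carryY) (farSpineE weightX lspineX carryX))
        (trans far-eval (cong +_ (trans (sym (insR-lspine d x y)) (sym (lspine-finish r))))) ,
  trans (xTaller rspineY (farSpineE weightY rspineY carryY) (lowE weightX carryX))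
        (trans near-eval (cong +_ (trans (sym (rspineT-root t)) (sym (rspine-finish r)))))
  where
    X = suc (d + k) , x
    Y = k , y
    r = insR (suc d) refl x y
    t = lastTree r
    k<m = s≤s (m≤n+m k d)
    xTaller = λ onEqual onYTaller onXTaller → eval-byHeight-> X Y onEqual onYTaller onXTaller k<m
    carry-eval : eval carryX (inputs X Y)
               ≡ + (rspineT (rightChild t) + surplus t * 2 ^ (d + k) + overflow r * 2 ^ suc (d + k))
    carry-eval = trans
      (eval-carryE {ρ = inputs X Y} weightY rspineX rspineY refl (cong +_ (rspineT-split (suc d) x))
        (rspineT<2^n (rightSubtree (suc d) x)) (2^k∣rspineAbove (suc d) x) refl)
      (cong +_ (trans (sym (insR-carry (suc d) x y)) (cong (_+ overflow r * 2 ^ suc (d + k)) (rspineT-root t))))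
    results = eval-tallerJoin {ρ = inputs X Y} weightX lspineX carryX {p = d + k} refl (cong +_ (lspineT-root x))
      (lspineT<2^n (leftChild x) , surplus≤1 x) carry-eval (rspineT<2^n (rightChild t) , surplus≤1 t) (overflow≤1 r)
    overflow-eval = proj₁ results
    near-eval = proj₁ (proj₂ results)
    far-eval = proj₂ (proj₂ results)

formulas-yTaller : ∀ {m k} d (eq : suc d + k ≡ m) (x : T k) (y : T m) →
  FormulasCorrect (k , x) (m , y) (finish (insL (suc d) eq x y))
formulas-yTaller {k = k} d refl x y =
  ⇔-trans (≡+o⇒[≡+1⇔o≡1] (trans (yTaller (lit (+ 1)) (overflowE weightY carryY) (overflowE weightX carryX)) overflow-eval))
          (⇔-trans (overflow≡1⇔finish-grows r (<⇒≤ k<m)) (↔⇒⇔ (×-comm _ _))) ,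
  trans (yTaller lspineX (lowE weightY carryY) (farSpineE weightX lspineX carryX))
        (trans near-eval (cong +_ (trans (sym (lspineT-root t)) (sym (lspine-finish r))))) ,
  trans (yTaller rspineY (farSpineE weightY rspineY carryY) (lowE weightX carryX))
        (trans far-eval (cong +_ (trans (sym (insL-rspine d x y)) (sym (rspine-finish r)))))
  where
    X = k , x
    Y = suc (d + k) , y
    r = insL (suc d) refl x y
    t = firstTree r
    k<m = s≤s (m≤n+m k d)
    yTaller = λ onEqual onYTaller onXTaller → eval-byHeight-< X Y onEqual onYTaller onXTaller k<m
    carry-eval : eval carryY (inputs X Y)
               ≡ + (lspineT (leftChild t) + surplus t * 2 ^ (d + k) + overflow r * 2 ^ suc (d + k))
    carry-eval = trans
      (eval-carryE {ρ = inputs X Y} weightX lspineY lspineX refl (cong +_ (lspineT-split (suc d) y))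
        (lspineT<2^n (leftSubtree (suc d) y)) (2^k∣lspineAbove (suc d) y) refl)
      (cong +_ (trans (sym (insL-carry (suc d) x y)) (cong (_+ overflow r * 2 ^ suc (d + k)) (lspineT-root t))))
    results = eval-tallerJoin {ρ = inputs X Y} weightY rspineY carryY {p = d + k} refl (cong +_ (rspineT-root y))
      (rspineT<2^n (rightChild y) , surplus≤1 y) carry-eval (lspineT<2^n (leftChild t) , surplus≤1 t) (overflow≤1 r)
    overflow-eval = proj₁ results
    near-eval = proj₁ (proj₂ results)
    far-eval = proj₂ (proj₂ results)

formulas-equal : ∀ {m} (x y : T m) → FormulasCorrect (m , x) (m , y) (suc m , node2 x y)
formulas-equal {m} x y =
  mk⇔ (λ _ → n<1+n m , n<1+n m) (λ _ → equalHeights (lit (+ 1)) (overflowE weightY carryY) (overflowE weightX carryX)) ,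
  equalHeights lspineX (lowE weightY carryY) (farSpineE weightX lspineX carryX) ,
  equalHeights rspineY (farSpineE weightY rspineY carryY) (lowE weightX carryX)
  where
    equalHeights = λ onEqual onYTaller onXTaller → eval-byHeight-≡ (m , x) (m , y) onEqual onYTaller onXTaller refl

join-formulas : ∀ X Y → FormulasCorrect X Y (join X Y)
join-formulas (m , x) (n , y) with compare m n
... | less .m k    = formulas-yTaller k (cong suc (+-comm k m)) x y
... | equal .m     = formulas-equal x y
... | greater .n k = formulas-xTaller k (cong suc (+-comm k n)) x y

mainTheorem12 : Σ (Expr 6) λ eOver → Σ (Expr 6) λ eL → Σ (Expr 6) λ eR →
    ∀ (X Y : Tree23) →
      ((eval eOver (inputs X Y) ≡ + 1) ⇔ Overflows X Y)
      × eval eL (inputs X Y) ≡ + lspine (join X Y)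
      × eval eR (inputs X Y) ≡ + rspine (join X Y)
mainTheorem12 = overflowExpr , lspineExpr , rspineExpr , join-formulas
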